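{- Let $m$ be odd and let $Q_{4m}=\langle a,b\mid a^{2m}=e,\ a^m=b^2,\ b^{ -1}ab=a^{ -1}\rangle$ be the dicyclic group of order $4m$. Then there is no inverse-closed $S\subseteq Q_{4m}\setminus\{e\}$ such that $\mathrm{Cay}(Q_{4m},S)$ is a non-trivial bipartite distance-regular graph with diameter $3$.
   Context: For a finite group $G$ and an inverse-closed $S\subseteq G\setminus\{e\}$, $\mathrm{Cay}(G,S)$ has vertex set $G$, with $a\sim b$ iff $ab^{ -1}\in S$. A bipartite distance-regular graph of diameter $3$ on $2n$ vertices has intersection array $\{k,k-1,k-\mu;1,\mu,k\}$ (for vertices $x,y$ at distance $i$, $x$ has $b_i$ neighbours at distance $i+1$ and $c_i$ neighbours at distance $i-1$ from $y$); it is called non-trivial if $k<n-1$ (equivalently $\mu<k-1$), i.e. it is not the complete bipartite graph $K_{n,n}$ minus a perfect matching. -}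

module Defs where

open import Data.Nat using (ℕ; zero; suc; _+_; _*_; _∸_; _≤_; _<_)
open import Data.Nat.DivMod using (_mod_)
open import Data.Fin using (Fin; toℕ)
open import Data.Bool using (Bool; true; false)
open import Data.Product using (Σ; _×_; _,_)
open import Data.List using (List; length)
open import Data.List.Relation.Unary.Unique.Propositional using (Unique)
open import Data.List.Membership.Propositional using (_∈_)
open import Relation.Binary.PropositionalEquality using (_≡_; _≢_)
open import Relation.Nullary using (¬_)
open import Function.Bundles using (_⇔_)
open import Level using (Level; _⊔_)

addF : ∀ {N} → Fin N → Fin N → Fin N
addF {suc n} i k = (toℕ i + toℕ k) mod suc n

subF : ∀ {N} → Fin N → Fin N → Fin N
subF {suc n} i k = (toℕ i + (suc n ∸ toℕ k)) mod suc n

shiftF : ∀ {N} → Fin N → ℕ → Fin N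
shiftF {suc n} i c = (toℕ i + c) mod suc n

-- The element ⟨ i , false ⟩ is a^i, the element ⟨ i , true ⟩ is a^i b,
-- with i ∈ ℤ/2mℤ.  Using b a^k = a^{-k} b and b² = a^m:
--   a^i   · a^k b^l = a^{i+k} b^l
--   a^i b · a^k     = a^{i-k} b
--   a^i b · a^k b   = a^{i-k+m}

record Dic (m : ℕ) : Set where
  constructor ⟨_,_⟩
  field
    expo : Fin (2 * m)
    hasB : Bool

module _ {m : ℕ} where

  _·_ : Dic m → Dic m → Dic m
  ⟨ i , false ⟩ · ⟨ k , l ⟩     = ⟨ addF i k , l ⟩
  ⟨ i , true ⟩  · ⟨ k , false ⟩ = ⟨ subF i k , true ⟩
  ⟨ i , true ⟩  · ⟨ k , true ⟩  = ⟨ shiftF (subF i k) m , false ⟩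

  inv : Dic m → Dic m
  inv ⟨ i , false ⟩ = ⟨ subF i (addF i i) , false ⟩   -- i - 2i = -i
  inv ⟨ i , true ⟩  = ⟨ shiftF i m , true ⟩

-- identity element e = a^0 (only exists when m ≥ 1)
IsIdentity : ∀ {m} → Dic m → Set
IsIdentity ⟨ i , b ⟩ = (toℕ i ≡ 0) × (b ≡ false)

CayAdj : ∀ {m} → (Dic m → Bool) → Dic m → Dic m → Set
CayAdj S x y = S (x · inv y) ≡ true

module Graph {a r : Level} {V : Set a} (Adj : V → V → Set r) where

  data Walk : V → V → ℕ → Set (a ⊔ r) where
    here  : ∀ {x} → Walk x x 0
    there : ∀ {x y z n} → Adj x y → Walk y z n → Walk x z (suc n)

  Dist : V → V → ℕ → Set (a ⊔ r)
  Dist x y d = Walk x y d × (∀ n → n < d → ¬ Walk x y n)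

  HasSize : ∀ {p} → (V → Set p) → ℕ → Set (a ⊔ p)
  HasSize P c = Σ (List V) λ l → Unique l × (∀ z → (z ∈ l) ⇔ P z) × (length l ≡ c)

  Bipartite : Set (a ⊔ r)
  Bipartite = Σ (V → Bool) λ col → ∀ x y → Adj x y → col x ≢ col y

  Diameter3 : Set (a ⊔ r)
  Diameter3 = (∀ x y → Σ ℕ λ d → d ≤ 3 × Dist x y d)
            × Σ V λ x → Σ V λ y → Dist x y 3

  HasIntersectionArray : (b₀ b₁ b₂ c₁ c₂ c₃ : ℕ) → Set (a ⊔ r)
  HasIntersectionArray b₀ b₁ b₂ c₁ c₂ c₃ =
      (∀ x y → Dist x y 0 → HasSize (λ z → Adj x z × Dist z y 1) b₀)
    × (∀ x y → Dist x y 1 → HasSize (λ z → Adj x z × Dist z y 2) b₁)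
    × (∀ x y → Dist x y 2 → HasSize (λ z → Adj x z × Dist z y 3) b₂)
    × (∀ x y → Dist x y 1 → HasSize (λ z → Adj x z × Dist z y 0) c₁)
    × (∀ x y → Dist x y 2 → HasSize (λ z → Adj x z × Dist z y 1) c₂)
    × (∀ x y → Dist x y 3 → HasSize (λ z → Adj x z × Dist z y 2) c₃)

  -- non-trivial bipartite distance-regular graph of diameter 3 on 2n
  -- vertices: valency k = b₀ satisfies k < n - 1.
  NontrivialBipDRG3 : (n : ℕ) → Set (a ⊔ r)
  NontrivialBipDRG3 n =
    Bipartite × Diameter3 ×
    Σ ℕ λ b₀ → Σ ℕ λ b₁ → Σ ℕ λ b₂ → Σ ℕ λ c₁ → Σ ℕ λ c₂ → Σ ℕ λ c₃ →
      HasIntersectionArray b₀ b₁ b₂ c₁ c₂ c₃ × (suc b₀ < n)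

-- Connectivity puts some a^j b into S.  If S also contained a rotation a^i,
-- then along the coset ⟨a⟩ a proper 2-colouring c would flip under
-- k ↦ k + i, yet be invariant under k ↦ k + m, because a^k and a^(k+m) have a
-- common neighbour in ⟨a⟩b; c(m·i) would then equal both c(0) and, m being
-- odd, not c(0).  So S ⊆ ⟨a⟩b, and since (a^j b)⁻¹ = a^(j+m) b, every vertex
-- x has a twin x·a^m with the same neighbourhood.  Twins at distance 2 force
-- c₂ ≥ k, so every neighbour of a vertex w at distance 2 from x is adjacent
-- to x, and no vertex is at distance 3.

module Submission where

open import Defs
open import Algebra.Properties.CommutativeSemigroup using (x∙yz≈y∙xz)
open import Data.Bool using (Bool; true; false; not) renaming (_≟_ to _≟ᵇ_)
open import Data.Bool.Properties using (not-¬; ¬-not; not-involutive)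
open import Data.Empty using (⊥; ⊥-elim)
open import Data.Fin using (Fin; toℕ)
open import Data.Fin.Properties using (toℕ-injective; toℕ<n; toℕ-fromℕ<) renaming (_≟_ to _≟ᶠ_)
open import Data.List using (List; []; _∷_; length; filter)
open import Data.List.Properties using (filter-notAll)
open import Data.List.Membership.Propositional.Properties using (∈-filter⁺)
open import Data.List.Relation.Binary.Subset.Propositional using (_⊆_)
open import Data.List.Relation.Unary.Any as Any using (here; there)
open import Data.List.Relation.Unary.All as All using ()
open import Data.List.Relation.Unary.All.Properties using (¬Any⇒All¬)
open import Data.List.Relation.Unary.AllPairs using (_∷_)
open import Data.List.Relation.Unary.Unique.Propositional using (Unique)
open import Data.Nat using (ℕ; zero; suc; pred; _+_; _*_; _∸_; _≤_; _%_; _/_; s≤s; z≤n)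
open import Data.Nat.DivMod
  using (_mod_; m≡m%n+[m/n]*n; %-distribˡ-+; m%n%n≡m%n; [m+n]%n≡m%n; m%n<n; m<n⇒m%n≡m)
open import Data.Nat.Properties
  using (≤-trans; <-irrefl; <⇒≤; +-assoc; +-comm; +-identityʳ; *-comm; m<m+n; m+[n∸m]≡n;
         m∸n+n≡m; +-commutativeSemigroup)
open import Data.Nat.Tactic.RingSolver using (solve-∀)
open import Data.Product using (Σ; _×_; _,_; proj₁; proj₂)
open import Function.Bundles using (Equivalence)
open import Relation.Binary.Bundles using (Setoid)
open import Relation.Binary.Definitions using (DecidableEquality)
open import Relation.Binary.Structures using (IsEquivalence)
open import Relation.Binary.PropositionalEquality
open import Function.Base using (_∘_)
open import Relation.Nullary using (¬_; yes; no; ¬?)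
import Relation.Binary.Reasoning.Setoid

module _ {A : Set} (_≟_ : DecidableEquality A) where

  Unique-⊆⇒length≤ : ∀ {xs ys : List A} → Unique xs → xs ⊆ ys → length xs ≤ length ys
  Unique-⊆⇒length≤ {[]}     _            _  = z≤n
  Unique-⊆⇒length≤ {x ∷ xs} {ys} (x∉xs ∷ u) xs⊆ys =
    ≤-trans (s≤s (Unique-⊆⇒length≤ u xs⊆ys-x)) (filter-notAll x≢? ys x∈ys)
    where
    x≢? = λ y → ¬? (x ≟ y)
    x∈ys = Any.map (λ x≡y x≢y → x≢y x≡y) (xs⊆ys (here refl))
    xs⊆ys-x : xs ⊆ filter x≢? ys
    xs⊆ys-x z∈xs = ∈-filter⁺ x≢? (xs⊆ys (there z∈xs)) (All.lookup x∉xs z∈xs)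

  Unique-⊆-length≥⇒⊇ : ∀ {xs ys : List A} → Unique xs → xs ⊆ ys →
                       length ys ≤ length xs → ys ⊆ xs
  Unique-⊆-length≥⇒⊇ {xs} u xs⊆ys ys≤xs {z} z∈ys with Any.any? (z ≟_) xs
  ... | yes z∈xs = z∈xs
  ... | no  z∉xs = ⊥-elim (<-irrefl refl
          (≤-trans (Unique-⊆⇒length≤ (¬Any⇒All¬ xs z∉xs ∷ u) z∷xs⊆ys) ys≤xs))
    where
    z∷xs⊆ys : (z ∷ xs) ⊆ _
    z∷xs⊆ys (here refl) = z∈ys
    z∷xs⊆ys (there p)   = xs⊆ys p

module GraphProperties {V : Set} (Adj : V → V → Set) where

  open Graph Adj

  walk₀⇒≡ : ∀ {x y} → Walk x y 0 → x ≡ y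
  walk₀⇒≡ here = refl

  walk₁⇒adj : ∀ {x y} → Walk x y 1 → Adj x y
  walk₁⇒adj (there x~y here) = x~y

  walk-snoc : ∀ {x y z n} → Walk x y n → Adj y z → Walk x z (suc n)
  walk-snoc here        y~z = there y~z here
  walk-snoc (there a w) y~z = there a (walk-snoc w y~z)

  dist-refl : ∀ {x} → Dist x x 0
  dist-refl = here , λ _ ()

  dist₁⇒adj : ∀ {x y} → Dist x y 1 → Adj x y
  dist₁⇒adj (w , _) = walk₁⇒adj w

  dist-prefix : ∀ {x y w n} → Dist x y (suc n) → Walk x w n → Adj w y → Dist x w n
  dist-prefix (_ , minimal) x⇝w w~y =
    x⇝w , λ k k<n x⇝w′ → minimal (suc k) (s≤s k<n) (walk-snoc x⇝w′ w~y)

  crossing-edge : (f : V → Bool) → ∀ {x y n} → Walk x y n → f x ≢ f y →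
                  Σ V λ u → Σ V λ v → Adj u v × f u ≢ f v
  crossing-edge f {x} (there {y = y} x~y w) fx≢fz with f x ≟ᵇ f y
  ... | yes fx≡fy = crossing-edge f w λ fy≡fz → fx≢fz (trans fx≡fy fy≡fz)
  ... | no  fx≢fy = x , y , x~y , fx≢fy
  crossing-edge f here fx≢fx = ⊥-elim (fx≢fx refl)

module DistanceRegular {V : Set} (_≟_ : DecidableEquality V) (Adj : V → V → Set)
  (adj-sym : ∀ {x y} → Adj x y → Adj y x) (adj-irrefl : ∀ {x} → ¬ Adj x x) where

  open Graph Adj
  open GraphProperties Adj

  HasSize-mono : ∀ {P Q : V → Set} {b c} → HasSize P b → HasSize Q c →
                 (∀ {z} → P z → Q z) → b ≤ c
  HasSize-mono (xs , u , P⇔ , refl) (ys , _ , Q⇔ , refl) P⇒Q =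
    Unique-⊆⇒length≤ _≟_ u λ {z} z∈xs →
      Equivalence.from (Q⇔ z) (P⇒Q (Equivalence.to (P⇔ z) z∈xs))

  HasSize-saturated : ∀ {P Q : V → Set} {b c} → HasSize P b → HasSize Q c →
                      (∀ {z} → P z → Q z) → c ≤ b → ∀ {z} → Q z → P z
  HasSize-saturated (xs , u , P⇔ , refl) (ys , _ , Q⇔ , refl) P⇒Q c≤b {z} Qz =
    Equivalence.to (P⇔ z) (Unique-⊆-length≥⇒⊇ _≟_ u xs⊆ys c≤b (Equivalence.from (Q⇔ z) Qz))
    where
    xs⊆ys : xs ⊆ ys
    xs⊆ys {y} y∈xs = Equivalence.from (Q⇔ y) (P⇒Q (Equivalence.to (P⇔ y) y∈xs))

  adj⇒dist₁ : ∀ {x y} → Adj x y → Dist x y 1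
  adj⇒dist₁ x~y = there x~y here , λ
    { zero    _ w → adj-irrefl (subst (Adj _) (sym (walk₀⇒≡ w)) x~y)
    ; (suc _) (s≤s ()) }

  Twin : V → V → Set
  Twin x x′ = x ≢ x′ × (∀ {z} → Adj z x → Adj z x′)

  twin-dist₂ : ∀ {x x′ z} → Twin x x′ → Adj x z → Dist x x′ 2
  twin-dist₂ (x≢x′ , N⊆N′) x~z = there x~z (there (N⊆N′ (adj-sym x~z)) here) , λ
    { zero          _                 w → x≢x′ (walk₀⇒≡ w)
    ; (suc zero)    _                 w → adj-irrefl (N⊆N′ (adj-sym (walk₁⇒adj w)))
    ; (suc (suc _)) (s≤s (s≤s ())) }

  module _ {b₀ b₁ b₂ c₁ c₂ c₃} (array : HasIntersectionArray b₀ b₁ b₂ c₁ c₂ c₃) where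

    private
      k-set = proj₁ array
      c₂-set = proj₁ (proj₂ (proj₂ (proj₂ (proj₂ array))))

    twin⇒b₀≤c₂ : ∀ {x x′} → Twin x x′ → Dist x x′ 2 → b₀ ≤ c₂
    twin⇒b₀≤c₂ {x} {x′} (_ , N⊆N′) d₂ = HasSize-mono (k-set x x dist-refl) (c₂-set x x′ d₂)
      λ (x~z , d₁) → x~z , adj⇒dist₁ (N⊆N′ (dist₁⇒adj d₁))

    b₀≤c₂⇒adj : b₀ ≤ c₂ → ∀ {x w y} → Dist x w 2 → Adj w y → Adj x y
    b₀≤c₂⇒adj b₀≤c₂ {x} {w} {y} d₂ w~y =
      proj₁ (HasSize-saturated (c₂-set x w d₂) (k-set w w dist-refl)
        (λ (_ , d₁) → adj-sym (dist₁⇒adj d₁) , d₁) b₀≤c₂ (w~y , adj⇒dist₁ (adj-sym w~y)))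

    twins⇒¬diameter3 : (∀ x → Σ V (Twin x)) → ¬ Diameter3
    twins⇒¬diameter3 twin (_ , x , y , d₃@(there x~u (there u~w (there w~y here)) , minimal)) =
      minimal 1 (s≤s (s≤s z≤n)) (there (b₀≤c₂⇒adj b₀≤c₂ d₂ w~y) here)
      where
      d₂ = dist-prefix d₃ (there x~u (there u~w here)) w~y
      b₀≤c₂ = twin⇒b₀≤c₂ (proj₂ (twin x)) (twin-dist₂ (proj₂ (twin x)) x~u)

module _ {A : Set} (c : ℕ → A) where

  periodic : ∀ {d} → (∀ k → c (k + d) ≡ c k) → ∀ n k → c (k + n * d) ≡ c k
  periodic {d} period zero    k = cong c (+-identityʳ k)
  periodic {d} period (suc n) k = begin
    c (k + (d + n * d)) ≡⟨ cong c (sym (+-assoc k d (n * d))) ⟩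
    c (k + d + n * d)   ≡⟨ periodic period n (k + d) ⟩
    c (k + d)           ≡⟨ period k ⟩
    c k                 ∎
    where open ≡-Reasoning

module _ (c : ℕ → Bool) where

  antiperiodic-odd : ∀ {d} → (∀ k → c (k + d) ≡ not (c k)) →
                     ∀ q k → c (k + (1 + q * 2) * d) ≡ not (c k)
  antiperiodic-odd {d} flip q k = begin
    c (k + (1 + q * 2) * d)   ≡⟨ cong c (lemma k d q) ⟩
    c (k + d + q * (d + d))   ≡⟨ periodic c period₂ q (k + d) ⟩
    c (k + d)                 ≡⟨ flip k ⟩
    not (c k)                 ∎
    where
    open ≡-Reasoning
    lemma : ∀ k d q → k + (1 + q * 2) * d ≡ k + d + q * (d + d)
    lemma = solve-∀
    period₂ : ∀ k → c (k + (d + d)) ≡ c k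
    period₂ k = begin
      c (k + (d + d))  ≡⟨ cong c (sym (+-assoc k d d)) ⟩
      c (k + d + d)    ≡⟨ flip (k + d) ⟩
      not (c (k + d))  ≡⟨ cong not (flip k) ⟩
      not (not (c k))  ≡⟨ not-involutive (c k) ⟩
      c k              ∎

  odd-period⇒¬antiperiod : ∀ {m d} → m % 2 ≡ 1 → (∀ k → c (k + m) ≡ c k) →
                           ¬ (∀ k → c (k + d) ≡ not (c k))
  odd-period⇒¬antiperiod {m} {d} odd period flip = not-¬ refl (begin
    c 0                       ≡⟨ periodic c period d 0 ⟨
    c (d * m)                 ≡⟨ cong c (trans (*-comm d m) (cong (_* d) m≡1+q*2)) ⟩
    c ((1 + q * 2) * d)       ≡⟨ antiperiodic-odd flip q 0 ⟩
    not (c 0)                 ∎)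
    where
    open ≡-Reasoning
    q = m / 2
    m≡1+q*2 : m ≡ 1 + q * 2
    m≡1+q*2 = trans (m≡m%n+[m/n]*n m 2) (cong (_+ q * 2) odd)

module Congruence (n : ℕ) where

  N : ℕ
  N = suc n

  infix 4 _≈_
  record _≈_ (a b : ℕ) : Set where
    constructor mk≈
    field ≈⇒%≡ : a % N ≡ b % N

  ≈-isEquivalence : IsEquivalence _≈_
  ≈-isEquivalence = record
    { refl  = mk≈ refl
    ; sym   = λ (mk≈ p) → mk≈ (sym p)
    ; trans = λ (mk≈ p) (mk≈ q) → mk≈ (trans p q) }

  ≈-setoid : Setoid _ _
  ≈-setoid = record { isEquivalence = ≈-isEquivalence }

  open IsEquivalence ≈-isEquivalence public
    using () renaming (refl to ≈-refl; sym to ≈-sym; trans to ≈-trans)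

  ≡⇒≈ : ∀ {a b} → a ≡ b → a ≈ b
  ≡⇒≈ refl = ≈-refl

  +-cong : ∀ {a a′ b b′} → a ≈ a′ → b ≈ b′ → a + b ≈ a′ + b′
  +-cong {a} {a′} {b} {b′} (mk≈ p) (mk≈ q) = mk≈ (begin
    (a + b) % N              ≡⟨ %-distribˡ-+ a b N ⟩
    (a % N + b % N) % N      ≡⟨ cong₂ (λ u v → (u + v) % N) p q ⟩
    (a′ % N + b′ % N) % N    ≡⟨ %-distribˡ-+ a′ b′ N ⟨
    (a′ + b′) % N            ∎)
    where open ≡-Reasoning

  +-congˡ : ∀ a {b b′} → b ≈ b′ → a + b ≈ a + b′
  +-congˡ a = +-cong ≈-refl

  +-congʳ : ∀ {a a′} b → a ≈ a′ → a + b ≈ a′ + b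
  +-congʳ b p = +-cong p ≈-refl

  %≈ : ∀ a → a % N ≈ a
  %≈ a = mk≈ (m%n%n≡m%n a N)

  +N≈ : ∀ a → a + N ≈ a
  +N≈ a = mk≈ ([m+n]%n≡m%n a N)

  +-cancelʳ : ∀ {a b} c → a + c ≈ b + c → a ≈ b
  +-cancelʳ {a} {b} c a+c≈b+c = begin
    a                    ≈⟨ undo a ⟨
    a + c + (N ∸ c % N)  ≈⟨ +-congʳ (N ∸ c % N) a+c≈b+c ⟩
    b + c + (N ∸ c % N)  ≈⟨ undo b ⟩
    b                    ∎
    where
    open Relation.Binary.Reasoning.Setoid ≈-setoid
    undo : ∀ x → x + c + (N ∸ c % N) ≈ x
    undo x = begin
      x + c + (N ∸ c % N)        ≡⟨ +-assoc x c _ ⟩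
      x + (c + (N ∸ c % N))      ≈⟨ +-congˡ x (+-congʳ (N ∸ c % N) (≈-sym (%≈ c))) ⟩
      x + (c % N + (N ∸ c % N))  ≡⟨ cong (x +_) (m+[n∸m]≡n (<⇒≤ (m%n<n c N))) ⟩
      x + N                      ≈⟨ +N≈ x ⟩
      x                          ∎

  ∃-difference : ∀ a b → Σ ℕ λ t → a + t ≈ b
  ∃-difference a b = b + (N ∸ a % N) , (begin
    a + (b + (N ∸ a % N))      ≡⟨ x∙yz≈y∙xz +-commutativeSemigroup a b (N ∸ a % N) ⟩
    b + (a + (N ∸ a % N))      ≈⟨ +-congˡ b (+-congʳ (N ∸ a % N) (≈-sym (%≈ a))) ⟩
    b + (a % N + (N ∸ a % N))  ≡⟨ cong (b +_) (m+[n∸m]≡n (<⇒≤ (m%n<n a N))) ⟩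
    b + N                      ≈⟨ +N≈ b ⟩
    b                          ∎)
    where open Relation.Binary.Reasoning.Setoid ≈-setoid

  toℕ-mod : ∀ a → toℕ (a mod N) ≈ a
  toℕ-mod a = ≈-trans (≡⇒≈ (toℕ-fromℕ< (m%n<n a N))) (%≈ a)

  toℕ-≈-injective : {e f : Fin N} → toℕ e ≈ toℕ f → e ≡ f
  toℕ-≈-injective {e} {f} (mk≈ p) =
    toℕ-injective (trans (sym (m<n⇒m%n≡m (toℕ<n e))) (trans p (m<n⇒m%n≡m (toℕ<n f))))

  mod-cong : ∀ {a b} → a ≈ b → a mod N ≡ b mod N
  mod-cong {a} {b} p = toℕ-≈-injective (≈-trans (toℕ-mod a) (≈-trans p (≈-sym (toℕ-mod b))))

  toℕ-mod-inverse : (e : Fin N) → toℕ e mod N ≡ e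
  toℕ-mod-inverse e = toℕ-≈-injective (toℕ-mod (toℕ e))

  toℕ-addF : (i k : Fin N) → toℕ (addF i k) ≈ toℕ i + toℕ k
  toℕ-addF i k = toℕ-mod _

  toℕ-shiftF : (i : Fin N) (c : ℕ) → toℕ (shiftF i c) ≈ toℕ i + c
  toℕ-shiftF i c = toℕ-mod _

  toℕ-subF : (i k : Fin N) → toℕ (subF i k) + toℕ k ≈ toℕ i
  toℕ-subF i k = begin
    toℕ (subF i k) + toℕ k           ≈⟨ +-congʳ (toℕ k) (toℕ-mod _) ⟩
    toℕ i + (N ∸ toℕ k) + toℕ k      ≡⟨ +-assoc (toℕ i) _ (toℕ k) ⟩
    toℕ i + (N ∸ toℕ k + toℕ k)      ≡⟨ cong (toℕ i +_) (m∸n+n≡m (<⇒≤ (toℕ<n k))) ⟩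
    toℕ i + N                        ≈⟨ +N≈ (toℕ i) ⟩
    toℕ i                            ∎
    where open Relation.Binary.Reasoning.Setoid ≈-setoid

  toℕ-negate : (j : Fin N) → toℕ (subF j (addF j j)) + toℕ j ≈ 0
  toℕ-negate j = +-cancelʳ (toℕ j) (begin
    toℕ (subF j jj) + toℕ j + toℕ j    ≡⟨ +-assoc (toℕ (subF j jj)) (toℕ j) (toℕ j) ⟩
    toℕ (subF j jj) + (toℕ j + toℕ j)  ≈⟨ +-congˡ (toℕ (subF j jj)) (≈-sym (toℕ-addF j j)) ⟩
    toℕ (subF j jj) + toℕ jj           ≈⟨ toℕ-subF j jj ⟩
    toℕ j                              ∎)
    where
    open Relation.Binary.Reasoning.Setoid ≈-setoid
    jj = addF j j

module Dicyclic (m′ : ℕ) where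

  m : ℕ
  m = suc m′

  -- Since m is a successor, suc (pred (2 * m)) reduces to 2 * m.
  open Congruence (pred (2 * m)) public

  a[_] : ℕ → Dic m
  a[ k ] = ⟨ k mod N , false ⟩

  a[_]b : ℕ → Dic m
  a[ k ]b = ⟨ k mod N , true ⟩

  a[]b-cong : ∀ {k l} → k ≈ l → a[ k ]b ≡ a[ l ]b
  a[]b-cong k≈l = cong (λ e → ⟨ e , true ⟩) (mod-cong k≈l)

  a[toℕ] : (e : Fin N) → a[ toℕ e ] ≡ ⟨ e , false ⟩
  a[toℕ] e = cong (λ e → ⟨ e , false ⟩) (toℕ-mod-inverse e)

  a[toℕ]b : (e : Fin N) → a[ toℕ e ]b ≡ ⟨ e , true ⟩
  a[toℕ]b e = cong (λ e → ⟨ e , true ⟩) (toℕ-mod-inverse e)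

  +m+m≈ : ∀ k → k + m + m ≈ k
  +m+m≈ k = ≈-trans (≡⇒≈ (trans (+-assoc k m m) (cong (λ l → k + (m + l)) (sym (+-identityʳ m)))))
                    (+N≈ k)

  m≉0 : ¬ m ≈ 0
  m≉0 (mk≈ m%N≡0) with trans (sym (m<n⇒m%n≡m (m<m+n m {m + 0} (s≤s z≤n)))) m%N≡0
  ... | ()

  a·a⁻¹ : ∀ k l → a[ l + k ] · inv a[ l ] ≡ a[ k ]
  a·a⁻¹ k l = cong (λ e → ⟨ e , false ⟩) (toℕ-≈-injective (+-cancelʳ l (begin
    toℕ (addF l+k -l) + l                      ≈⟨ +-congʳ l (toℕ-addF l+k -l) ⟩
    toℕ l+k + toℕ -l + l                       ≈⟨ +-congˡ (toℕ l+k + toℕ -l) (toℕ-mod l) ⟨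
    toℕ l+k + toℕ -l + toℕ (l mod N)           ≡⟨ +-assoc (toℕ l+k) (toℕ -l) _ ⟩
    toℕ l+k + (toℕ -l + toℕ (l mod N))         ≈⟨ +-congˡ (toℕ l+k) (toℕ-negate (l mod N)) ⟩
    toℕ l+k + 0                                ≡⟨ +-identityʳ (toℕ l+k) ⟩
    toℕ l+k                                    ≈⟨ toℕ-mod (l + k) ⟩
    l + k                                      ≡⟨ +-comm l k ⟩
    k + l                                      ≈⟨ +-congʳ l (toℕ-mod k) ⟨
    toℕ (k mod N) + l                          ∎)))
    where
    open Relation.Binary.Reasoning.Setoid ≈-setoid
    l+k = (l + k) mod N
    -l = subF (l mod N) (addF (l mod N) (l mod N))

  a·ab⁻¹ : ∀ k l → a[ k ] · inv a[ l ]b ≡ a[ k + l + m ]b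
  a·ab⁻¹ k l = a[]b-cong (begin
    toℕ (k mod N) + toℕ (shiftF (l mod N) m)   ≈⟨ +-cong (toℕ-mod k) (toℕ-shiftF (l mod N) m) ⟩
    k + (toℕ (l mod N) + m)                    ≈⟨ +-congˡ k (+-congʳ m (toℕ-mod l)) ⟩
    k + (l + m)                                ≡⟨ +-assoc k l m ⟨
    k + l + m                                  ∎)
    where open Relation.Binary.Reasoning.Setoid ≈-setoid

  ab·a⁻¹ : ∀ k l → a[ k ]b · inv a[ l ] ≡ a[ k + l ]b
  ab·a⁻¹ k l = trans (sym (a[toℕ]b _)) (a[]b-cong (begin
    toℕ (subF k′ -l)                                   ≡⟨ +-identityʳ _ ⟨
    toℕ (subF k′ -l) + 0                               ≈⟨ +-congˡ _ (toℕ-negate (l mod N)) ⟨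
    toℕ (subF k′ -l) + (toℕ -l + toℕ (l mod N))        ≡⟨ +-assoc (toℕ (subF k′ -l)) (toℕ -l) _ ⟨
    toℕ (subF k′ -l) + toℕ -l + toℕ (l mod N)          ≈⟨ +-cong (toℕ-subF k′ -l) (toℕ-mod l) ⟩
    toℕ k′ + l                                         ≈⟨ +-congʳ l (toℕ-mod k) ⟩
    k + l                                              ∎))
    where
    open Relation.Binary.Reasoning.Setoid ≈-setoid
    k′ = k mod N
    -l = subF (l mod N) (addF (l mod N) (l mod N))

  Dic-elim₂ : (R : Dic m → Dic m → Set) →
              (∀ k l → R a[ k ] a[ l ]) → (∀ k l → R a[ k ] a[ l ]b) →
              (∀ k l → R a[ k ]b a[ l ]) → (∀ k l → R a[ k ]b a[ l ]b) →
              ∀ x y → R x y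
  Dic-elim₂ R Rₐₐ Rₐᵦ Rᵦₐ Rᵦᵦ ⟨ e , u ⟩ ⟨ f , v ⟩ =
    subst₂ R (toℕ-normal e u) (toℕ-normal f v) (cases u v)
    where
    normal : ℕ → Bool → Dic m
    normal k l = ⟨ k mod N , l ⟩
    toℕ-normal : ∀ e l → normal (toℕ e) l ≡ ⟨ e , l ⟩
    toℕ-normal e l = cong (λ e → ⟨ e , l ⟩) (toℕ-mod-inverse e)
    cases : ∀ u v → R (normal (toℕ e) u) (normal (toℕ f) v)
    cases false false = Rₐₐ (toℕ e) (toℕ f)
    cases false true  = Rₐᵦ (toℕ e) (toℕ f)
    cases true  false = Rᵦₐ (toℕ e) (toℕ f)
    cases true  true  = Rᵦᵦ (toℕ e) (toℕ f)

  _≟_ : DecidableEquality (Dic m)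
  ⟨ e , u ⟩ ≟ ⟨ f , v ⟩ with e ≟ᶠ f | u ≟ᵇ v
  ... | yes refl | yes refl = yes refl
  ... | no  e≢f  | _        = no λ { refl → e≢f refl }
  ... | yes _    | no  u≢v  = no λ { refl → u≢v refl }

  _·aᵐ : Dic m → Dic m
  ⟨ e , u ⟩ ·aᵐ = ⟨ shiftF e m , u ⟩

  ·aᵐ-≢ : ∀ x → x ≢ x ·aᵐ
  ·aᵐ-≢ ⟨ e , u ⟩ x≡x·aᵐ = m≉0 (+-cancelʳ (toℕ e) (begin
    m + toℕ e          ≡⟨ +-comm m (toℕ e) ⟩
    toℕ e + m          ≈⟨ toℕ-shiftF e m ⟨
    toℕ (shiftF e m)   ≡⟨ cong (toℕ ∘ Dic.expo) x≡x·aᵐ ⟨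
    toℕ e              ∎))
    where open Relation.Binary.Reasoning.Setoid ≈-setoid

  module Cayley (S : Dic m → Bool) (inv-closed : ∀ g → S g ≡ true → S (inv g) ≡ true) where

    open Graph (CayAdj S)
    open GraphProperties (CayAdj S)

    S-a[]b-cong : ∀ {k l} → k ≈ l → S a[ k ]b ≡ S a[ l ]b
    S-a[]b-cong k≈l = cong S (a[]b-cong k≈l)

    S-a[]b-shift : ∀ {k l} → S a[ k ]b ≡ true → l ≈ k + m → S a[ l ]b ≡ true
    S-a[]b-shift {k} Sk l≈k+m =
      trans (S-a[]b-cong (≈-trans l≈k+m (+-congʳ m (≈-sym (toℕ-mod k))))) (inv-closed _ Sk)

    a~ab⇒ : ∀ k l → CayAdj S a[ k ] a[ l ]b → S a[ k + l + m ]b ≡ true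
    a~ab⇒ k l = trans (cong S (sym (a·ab⁻¹ k l)))

    a~ab⇐ : ∀ k l → S a[ k + l + m ]b ≡ true → CayAdj S a[ k ] a[ l ]b
    a~ab⇐ k l = trans (cong S (a·ab⁻¹ k l))

    ab~a⇒ : ∀ k l → CayAdj S a[ k ]b a[ l ] → S a[ k + l ]b ≡ true
    ab~a⇒ k l = trans (cong S (sym (ab·a⁻¹ k l)))

    ab~a⇐ : ∀ k l → S a[ k + l ]b ≡ true → CayAdj S a[ k ]b a[ l ]
    ab~a⇐ k l = trans (cong S (ab·a⁻¹ k l))

    cross-edge⇒a[]b∈S : ∀ {x y} → CayAdj S x y → Dic.hasB x ≢ Dic.hasB y →
                        Σ ℕ λ j → S a[ j ]b ≡ true
    cross-edge⇒a[]b∈S {⟨ _ , false ⟩} {⟨ _ , false ⟩} _   ≢ = ⊥-elim (≢ refl)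
    cross-edge⇒a[]b∈S {⟨ i , false ⟩} {⟨ j , true ⟩}  adj _ = toℕ i + toℕ (shiftF j m) , adj
    cross-edge⇒a[]b∈S {⟨ i , true ⟩}  {⟨ j , false ⟩} adj _ = toℕ g , trans (cong S (a[toℕ]b g)) adj
      where g = subF i (subF j (addF j j))
    cross-edge⇒a[]b∈S {⟨ _ , true ⟩}  {⟨ _ , true ⟩}  _   ≢ = ⊥-elim (≢ refl)

    connected⇒a[]b∈S : ∀ {n} → Walk a[ 0 ] a[ 0 ]b n → Σ ℕ λ j → S a[ j ]b ≡ true
    connected⇒a[]b∈S walk with crossing-edge Dic.hasB walk (λ ())
    ... | _ , _ , adj , differ = cross-edge⇒a[]b∈S adj differ

    odd-bipartite⇒a[]∉S : m % 2 ≡ 1 →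
                          (col : Dic m → Bool) → (∀ x y → CayAdj S x y → col x ≢ col y) →
                          ∀ j → S a[ j ]b ≡ true → ∀ e → S ⟨ e , false ⟩ ≡ false
    odd-bipartite⇒a[]∉S odd col proper j Sj e with S ⟨ e , false ⟩ in Se
    ... | false = refl
    ... | true  = ⊥-elim (odd-period⇒¬antiperiod c odd period antiperiod)
      where
      c : ℕ → Bool
      c k = col a[ k ]
      antiperiod : ∀ k → c (k + toℕ e) ≡ not (c k)
      antiperiod k = ¬-not (proper a[ k + toℕ e ] a[ k ]
        (trans (cong S (trans (a·a⁻¹ (toℕ e) k) (a[toℕ] e))) Se))
      period : ∀ k → c (k + m) ≡ c k
      period k = trans (¬-not k+m≁y) (sym (¬-not k≁y))
        where
        open Relation.Binary.Reasoning.Setoid ≈-setoid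
        t = proj₁ (∃-difference k j)
        k+t≈j : k + t ≈ j
        k+t≈j = proj₂ (∃-difference k j)
        k+m+t+m≈j : k + m + t + m ≈ j
        k+m+t+m≈j = begin
          k + m + t + m   ≡⟨ cong (_+ m) (+-assoc k m t) ⟩
          k + (m + t) + m ≡⟨ cong (λ n → k + n + m) (+-comm m t) ⟩
          k + (t + m) + m ≡⟨ cong (_+ m) (+-assoc k t m) ⟨
          k + t + m + m   ≈⟨ +m+m≈ (k + t) ⟩
          k + t           ≈⟨ k+t≈j ⟩
          j               ∎
        k+m≁y : col a[ k + m ] ≢ col a[ t ]b
        k+m≁y = proper a[ k + m ] a[ t ]b (a~ab⇐ (k + m) t (trans (S-a[]b-cong k+m+t+m≈j) Sj))
        k≁y : col a[ k ] ≢ col a[ t ]b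
        k≁y = ≢-sym (proper a[ t ]b a[ k ]
          (ab~a⇐ t k (trans (S-a[]b-cong (≈-trans (≡⇒≈ (+-comm t k)) k+t≈j)) Sj)))

    module RotationFree (a[]∉S : ∀ e → S ⟨ e , false ⟩ ≡ false) where

      ¬adj-within-coset : ∀ x y → Dic.hasB x ≡ Dic.hasB y → ¬ CayAdj S x y
      ¬adj-within-coset ⟨ _ , false ⟩ ⟨ _ , false ⟩ _ adj with trans (sym (a[]∉S _)) adj
      ... | ()
      ¬adj-within-coset ⟨ _ , true ⟩  ⟨ _ , true ⟩  _ adj with trans (sym (a[]∉S _)) adj
      ... | ()

      adj-irrefl : ∀ {x} → ¬ CayAdj S x x
      adj-irrefl {x} = ¬adj-within-coset x x refl

      adj-sym : ∀ {x y} → CayAdj S x y → CayAdj S y x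
      adj-sym {x} {y} = Dic-elim₂ (λ x y → CayAdj S x y → CayAdj S y x)
        (λ k l → ⊥-elim ∘ ¬adj-within-coset a[ k ] a[ l ] refl)
        (λ k l adj → ab~a⇐ l k (S-a[]b-shift (a~ab⇒ k l adj)
          (≈-sym (≈-trans (+m+m≈ (k + l)) (≡⇒≈ (+-comm k l))))))
        (λ k l adj → a~ab⇐ l k (S-a[]b-shift (ab~a⇒ k l adj)
          (≡⇒≈ (cong (_+ m) (+-comm l k)))))
        (λ k l → ⊥-elim ∘ ¬adj-within-coset a[ k ]b a[ l ]b refl) x y

      open DistanceRegular _≟_ (CayAdj S) adj-sym adj-irrefl public

      ·aᵐ-twin : ∀ x → Twin x (x ·aᵐ)
      ·aᵐ-twin x = ·aᵐ-≢ x , λ {z} → neighbour z x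
        where
        +l′+m≈ : ∀ k l → k + (toℕ (l mod N) + m) ≈ k + l + m
        +l′+m≈ k l = ≈-trans (+-congˡ k (+-congʳ m (toℕ-mod l))) (≡⇒≈ (sym (+-assoc k l m)))
        neighbour : ∀ z x → CayAdj S z x → CayAdj S z (x ·aᵐ)
        neighbour = Dic-elim₂ (λ z x → CayAdj S z x → CayAdj S z (x ·aᵐ))
          (λ k l → ⊥-elim ∘ ¬adj-within-coset a[ k ] a[ l ] refl)
          (λ k l adj → a~ab⇐ k _ (S-a[]b-shift (a~ab⇒ k l adj) (+-congʳ m (+l′+m≈ k l))))
          (λ k l adj → ab~a⇐ k _ (S-a[]b-shift (ab~a⇒ k l adj) (+l′+m≈ k l)))
          (λ k l → ⊥-elim ∘ ¬adj-within-coset a[ k ]b a[ l ]b refl)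

proposition5p3 : (m : ℕ) → m % 2 ≡ 1 →
    (S : Dic m → Bool) →
    (∀ g → IsIdentity g → S g ≡ false) →
    (∀ g → S g ≡ true → S (inv g) ≡ true) →
    ¬ Graph.NontrivialBipDRG3 (CayAdj S) (2 * m)
proposition5p3 zero ()
proposition5p3 (suc m′) odd S _ inv-closed
  ((col , proper) , diameter3@(connected , _) , _ , _ , _ , _ , _ , _ , array , _) =
  twins⇒¬diameter3 array (λ x → x ·aᵐ , ·aᵐ-twin x) diameter3
  where
  open Dicyclic m′
  open Cayley S inv-closed
  e⇝b = proj₁ (proj₂ (proj₂ (connected a[ 0 ] a[ 0 ]b)))
  ab∈S = connected⇒a[]b∈S e⇝b
  open RotationFree (odd-bipartite⇒a[]∉S odd col proper (proj₁ ab∈S) (proj₂ ab∈S))
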